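{- Let $n,k$ be positive integers and let $u,v$ be distinct vertices of the Kneser graph $K(2n+k,n)$, with $s=|u\cap v|$. Then $\mathit{dist}(u,v)=\mathit{diam}(K(2n+k,n))$ if and only if $$\left(\left\lceil \frac{n-1}{2k}\right\rceil-1\right)k+1\;\le\; s\;\le\;\left(\left\lceil \frac{n-1}{2k}\right\rceil-1\right)k+1+H(n,k),$$ where $$H(n,k)=\begin{cases}\max\{(n\bmod k)+k-2,\,0\}, & \text{if } 0\le n\bmod k\le 1,\\ (n\bmod k)-2, & \text{if } 2\le n\bmod k\le k-1.\end{cases}$$
   Context: For positive integers $n,k$, the Kneser graph $K(2n+k,n)$ has as vertex set all $n$-element subsets of $\{1,\ldots,2n+k\}$, two vertices $u,v$ being adjacent iff $u\cap v=\emptyset$. $\mathit{dist}(u,v)$ is the length (number of edges) of a shortest path between $u$ and $v$, and $\mathit{diam}(G)=\max_{u,v}\mathit{dist}(u,v)$. -}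

module Defs where

open import Data.Nat using (ℕ; zero; suc; _+_; _*_; _∸_; _≤_; _<_)
open import Data.Nat.DivMod using (_/_; _%_)
open import Data.Integer as ℤ using (ℤ; +_)
open import Data.Bool using (if_then_else_)
open import Data.Nat using (_≤ᵇ_)
open import Data.Fin.Subset using (Subset; _∩_; ∣_∣; Empty)
open import Data.Product using (Σ; proj₁; ∃; _×_)
open import Relation.Binary.PropositionalEquality using (_≡_)

-- Vertices of the Kneser graph K(N, n): n-element subsets of Fin N
-- (Fin N = {0,…,N-1} plays the role of {1,…,N}).
KVertex : ℕ → ℕ → Set
KVertex N n = Σ (Subset N) (λ u → ∣ u ∣ ≡ n)

Adj : ∀ {N n} → KVertex N n → KVertex N n → Set
Adj u v = Empty (proj₁ u ∩ proj₁ v)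

data Walk {N n : ℕ} : KVertex N n → KVertex N n → ℕ → Set where
  here : ∀ {u} → Walk u u 0
  step : ∀ {u w v m} → Adj u w → Walk w v m → Walk u v (suc m)

Dist : ∀ {N n} → KVertex N n → KVertex N n → ℕ → Set
Dist u v d = Walk u v d × (∀ m → m < d → Walk u v m → Data.Empty.⊥)
  where import Data.Empty

IsDiam : ℕ → ℕ → ℕ → Set
IsDiam N n D =
  (∃ λ (u : KVertex N n) → ∃ λ (v : KVertex N n) → Dist u v D)
  × (∀ (u v : KVertex N n) (d : ℕ) → Dist u v d → d ≤ D)

-- ⌈ (n-1) / (2k) ⌉ for n, k ≥ 1 (computed as ⌊(n-1 + 2k - 1)/(2k)⌋).
ceilTerm : (n k : ℕ) → ℕ
ceilTerm n k = ((n ∸ 1) + (2 * k ∸ 1)) / (2 * suc (k ∸ 1))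
-- note: for k ≥ 1, suc (k ∸ 1) = k; written this way so the divisor is NonZero.

-- H(n,k) (natural-number valued; max{.,0} realised by truncated subtraction).
H : ℕ → ℕ → ℕ
H n k = if (n % suc (k ∸ 1)) ≤ᵇ 1
          then (n % suc (k ∸ 1) + k) ∸ 2
          else n % suc (k ∸ 1) ∸ 2

-- Lower bound (⌈(n-1)/(2k)⌉ - 1) k + 1, as an integer (may be ≤ 0).
lowerB : ℕ → ℕ → ℤ
lowerB n k = (+ ceilTerm n k ℤ.- + 1) ℤ.* + k ℤ.+ + 1

upperB : ℕ → ℕ → ℤ
upperB n k = lowerB n k ℤ.+ + H n k

{-# OPTIONS --safe #-}
-- Write s = ∣u ∩ v∣. A step u ~ w forces ∣u ∩ v∣ + ∣w ∩ v∣ ≤ n ≤ ∣u ∩ v∣ + ∣w ∩ v∣ + k,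
-- and conversely two steps can exchange any r ≤ k points of u for r points outside u,
-- passing through a common neighbour in the complement of both. Hence u and v are
-- joined by a walk of length 2t iff n ≤ s + t k, and by one of length 2t + 1 iff
-- s ≤ t k. So dist(u, v) is the least such length, a function of s alone, and the
-- rest is arithmetic: for n ≥ 2 write n − 2 = q k + r and t = ⌊q/2⌋; then the largest
-- distance is D = q + 2, attained exactly when t k < s ≤ t k + 1 + r, and indeed
-- t = ⌈(n − 1)/(2k)⌉ − 1 and r = H(n, k).
module Submission where

open import Defs
open import Data.Nat using (ℕ; NonZero; zero; suc; _+_; _*_; _∸_; _≤_; _<_; _⊓_; _≤ᵇ_; z≤n; s≤s; _<?_)
open import Data.Nat.Properties
open import Data.Nat.DivMod
  using (_/_; _%_; m<n⇒m/n≡0; m*n/n≡m; +-distrib-/-∣ʳ; m≡m%n+[m/n]*n; [m+kn]%n≡m%n; m<n⇒m%n≡m; n%n≡0; [m+n]%n≡m%n; m%n<n)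
open import Data.Nat.Divisibility using (divides)
open import Data.Nat.Solver using (module +-*-Solver)
open import Data.Integer as ℤ using (+_; -[1+_]; +≤+; -≤+)
open import Data.Integer.Properties using (pos-*; drop‿+≤+; n⊖n≡0)
open import Data.Bool as Bool using (Bool; true; false; _∧_; _∨_; not; b≤b; if_then_else_)
open import Data.Bool.Properties as Boolₚ using ()
open import Data.Fin as Fin using (Fin)
open import Data.Vec using ([]; _∷_; lookup; here; there)
open import Data.Vec.Properties using (lookup-zipWith; lookup-map; lookup⇒[]=; []=⇒lookup)
open import Data.Fin.Subset using (Subset; _∩_; _∪_; ∁; ⊤; ⊥; ∣_∣; Empty; _⊆_; inside; outside)
open import Data.Fin.Subset.Properties
  using (x∈p∩q⁺; x∈p∩q⁻; x∈p∪q⁺; x∈p∪q⁻; x∉p⇒x∈∁p; x∈∁p⇒x∉p; x∉∁p⇒x∈p; out⊆; s⊆s; ∣∁p∣≡n∸∣p∣;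
         Empty-unique; ⊥⊆; ∣⊥∣≡0; ⊆-antisym; ⊆-trans; p∩q⊆p; p∩q⊆q; p⊆p∪q; q⊆p∪q; p⊆q⇒∁p⊇∁q;
         ∣p∩q∣≤∣p∣; ∣⊤∣≡n; ∩-idem; ∩-comm; ∩-identityʳ)
open import Algebra.Properties.CommutativeMonoid.Sum +-0-commutativeMonoid using (sum; ∑-distrib-+; sum-cong-≗)
open import Data.Product using (Σ; ∃-syntax; _×_; _,_; proj₁; proj₂)
open import Data.Sum as Sum using (inj₁; inj₂)
open import Function.Base using (_∘_)
open import Function.Bundles using (_⇔_; mk⇔; Equivalence)
open import Function.Properties.Equivalence using () renaming (trans to ⇔-trans; sym to ⇔-sym)
open import Relation.Binary.PropositionalEquality
open import Relation.Binary using (tri<; tri≈; tri>)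
open import Relation.Nullary using (¬_; yes; no)

open +-*-Solver

-- Cardinalities of subsets as sums of indicators

𝟙 : Bool → ℕ
𝟙 true  = 1
𝟙 false = 0

sum-mono-≤ : ∀ {N} {f g : Fin N → ℕ} → (∀ i → f i ≤ g i) → sum f ≤ sum g
sum-mono-≤ {zero}  _   = z≤n
sum-mono-≤ {suc N} f≤g = +-mono-≤ (f≤g Fin.zero) (sum-mono-≤ (f≤g ∘ Fin.suc))

sum-ones : ∀ N → sum {N} (λ _ → 1) ≡ N
sum-ones zero    = refl
sum-ones (suc N) = cong suc (sum-ones N)

sum-+₃ : ∀ {N} (f g h : Fin N → ℕ) → sum f + sum g + sum h ≡ sum (λ i → f i + g i + h i)
sum-+₃ f g h = trans (cong (_+ sum h) (sym (∑-distrib-+ f g))) (sym (∑-distrib-+ _ h))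

∣p∣≡sum : ∀ {N} (p : Subset N) → ∣ p ∣ ≡ sum (𝟙 ∘ lookup p)
∣p∣≡sum []            = refl
∣p∣≡sum (inside  ∷ p) = cong suc (∣p∣≡sum p)
∣p∣≡sum (outside ∷ p) = ∣p∣≡sum p

∣p∣+∣q∣≡sum : ∀ {N} (p q : Subset N) → ∣ p ∣ + ∣ q ∣ ≡ sum (λ i → 𝟙 (lookup p i) + 𝟙 (lookup q i))
∣p∣+∣q∣≡sum p q = trans (cong₂ _+_ (∣p∣≡sum p) (∣p∣≡sum q)) (sym (∑-distrib-+ (𝟙 ∘ lookup p) (𝟙 ∘ lookup q)))

⊆⇒lookup-≤ : ∀ {N} {p q : Subset N} → p ⊆ q → ∀ i → lookup p i Bool.≤ lookup q i
⊆⇒lookup-≤ {p = p} p⊆q i with lookup p i in eq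
... | false = Boolₚ.≤-minimum _
... | true  = subst (true Bool.≤_) (sym ([]=⇒lookup (p⊆q (lookup⇒[]= i p eq)))) b≤b

module _ {N : ℕ} {p q : Subset N} where

  lookup-∩ : ∀ i → lookup (p ∩ q) i ≡ lookup p i ∧ lookup q i
  lookup-∩ i = lookup-zipWith _∧_ i p q

  lookup-∪ : ∀ i → lookup (p ∪ q) i ≡ lookup p i ∨ lookup q i
  lookup-∪ i = lookup-zipWith _∨_ i p q

  ⊆∁⇒lookup-≤ : p ⊆ ∁ q → ∀ i → lookup p i Bool.≤ not (lookup q i)
  ⊆∁⇒lookup-≤ p⊆∁q i = subst (lookup p i Bool.≤_) (lookup-map i not q) (⊆⇒lookup-≤ p⊆∁q i)

  Empty∩⇒⊆∁ : Empty (p ∩ q) → p ⊆ ∁ q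
  Empty∩⇒⊆∁ p∩q=∅ x∈p = x∉p⇒x∈∁p (λ x∈q → p∩q=∅ (_ , x∈p∩q⁺ (x∈p , x∈q)))

  ⊆∁⇒Empty∩ : p ⊆ ∁ q → Empty (p ∩ q)
  ⊆∁⇒Empty∩ p⊆∁q (_ , x∈p∩q) with x∈p∩q⁻ p q x∈p∩q
  ... | x∈p , x∈q = x∈∁p⇒x∉p (p⊆∁q x∈p) x∈q

  ⊆∁-sym : p ⊆ ∁ q → q ⊆ ∁ p
  ⊆∁-sym p⊆∁q x∈q = x∉p⇒x∈∁p (λ x∈p → x∈∁p⇒x∉p (p⊆∁q x∈p) x∈q)

  ⊆⇒∣p∩q∣≡∣p∣ : p ⊆ q → ∣ p ∩ q ∣ ≡ ∣ p ∣
  ⊆⇒∣p∩q∣≡∣p∣ p⊆q = cong ∣_∣ (⊆-antisym (p∩q⊆p p q) (λ x∈p → x∈p∩q⁺ (x∈p , p⊆q x∈p)))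

  ⊆∁⇒∣p∩q∣≡0 : p ⊆ ∁ q → ∣ p ∩ q ∣ ≡ 0
  ⊆∁⇒∣p∩q∣≡0 p⊆∁q = trans (cong ∣_∣ (Empty-unique (⊆∁⇒Empty∩ p⊆∁q))) (∣⊥∣≡0 N)

∣p∣≡0⇒Empty : ∀ {N} {p : Subset N} → ∣ p ∣ ≡ 0 → Empty p
∣p∣≡0⇒Empty {p = outside ∷ p} ∣p∣≡0 (Fin.suc x , there x∈p) = ∣p∣≡0⇒Empty ∣p∣≡0 (x , x∈p)

∃-⊆-of-size : ∀ {N} (p : Subset N) {m} → m ≤ ∣ p ∣ → ∃[ q ] q ⊆ p × ∣ q ∣ ≡ m
∃-⊆-of-size {N} _ {zero} _ = ⊥ , ⊥⊆ , ∣⊥∣≡0 N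
∃-⊆-of-size (outside ∷ p) m≤∣p∣ =
  let q , q⊆p , ∣q∣≡m = ∃-⊆-of-size p m≤∣p∣ in outside ∷ q , out⊆ q⊆p , ∣q∣≡m
∃-⊆-of-size (inside ∷ p) {suc m} (s≤s m≤∣p∣) =
  let q , q⊆p , ∣q∣≡m = ∃-⊆-of-size p m≤∣p∣ in inside ∷ q , s⊆s q⊆p , cong suc ∣q∣≡m

∣p∣+m≤N⇒m≤∣∁p∣ : ∀ {N m} (p : Subset N) → ∣ p ∣ + m ≤ N → m ≤ ∣ ∁ p ∣
∣p∣+m≤N⇒m≤∣∁p∣ {N} {m} p ∣p∣+m≤N = begin
  m                    ≡⟨ m+n∸m≡n ∣ p ∣ m ⟨
  ∣ p ∣ + m ∸ ∣ p ∣    ≤⟨ ∸-monoˡ-≤ ∣ p ∣ ∣p∣+m≤N ⟩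
  N ∸ ∣ p ∣            ≡⟨ ∣∁p∣≡n∸∣p∣ p ⟨
  ∣ ∁ p ∣              ∎
  where open ≤-Reasoning

lookup-∩∁ : ∀ {N} (p q : Subset N) i → lookup (p ∩ ∁ q) i ≡ lookup p i ∧ not (lookup q i)
lookup-∩∁ p q i = trans (lookup-∩ {p = p} i) (cong (lookup p i ∧_) (lookup-map i not q))

∣p∩∁q∣+∣p∩q∣≡∣p∣ : ∀ {N} (p q : Subset N) → ∣ p ∩ ∁ q ∣ + ∣ p ∩ q ∣ ≡ ∣ p ∣
∣p∩∁q∣+∣p∩q∣≡∣p∣ p q = trans (∣p∣+∣q∣≡sum (p ∩ ∁ q) (p ∩ q)) (trans (sum-cong-≗ bits) (sym (∣p∣≡sum p)))
  where
  split : ∀ a b → 𝟙 (a ∧ not b) + 𝟙 (a ∧ b) ≡ 𝟙 a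
  split true  true  = refl
  split true  false = refl
  split false _     = refl
  bits : ∀ i → 𝟙 (lookup (p ∩ ∁ q) i) + 𝟙 (lookup (p ∩ q) i) ≡ 𝟙 (lookup p i)
  bits i rewrite lookup-∩∁ p q i | lookup-∩ {p = p} {q} i = split (lookup p i) (lookup q i)

∣p∪q∣≤∣p∣+∣q∣ : ∀ {N} (p q : Subset N) → ∣ p ∪ q ∣ ≤ ∣ p ∣ + ∣ q ∣
∣p∪q∣≤∣p∣+∣q∣ p q = begin
  ∣ p ∪ q ∣                                    ≡⟨ ∣p∣≡sum (p ∪ q) ⟩
  sum (𝟙 ∘ lookup (p ∪ q))                      ≤⟨ sum-mono-≤ bits ⟩
  sum (λ i → 𝟙 (lookup p i) + 𝟙 (lookup q i))  ≡⟨ ∣p∣+∣q∣≡sum p q ⟨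
  ∣ p ∣ + ∣ q ∣                                ∎
  where
  open ≤-Reasoning
  subadditive : ∀ a b → 𝟙 (a ∨ b) ≤ 𝟙 a + 𝟙 b
  subadditive true  _     = s≤s z≤n
  subadditive false true  = ≤-refl
  subadditive false false = z≤n
  bits : ∀ i → 𝟙 (lookup (p ∪ q) i) ≤ 𝟙 (lookup p i) + 𝟙 (lookup q i)
  bits i rewrite lookup-∪ {p = p} {q} i = subadditive (lookup p i) (lookup q i)

∣p∩r∣+∣q∩r∣≤∣r∣ : ∀ {N} {p q : Subset N} (r : Subset N) → Empty (p ∩ q) → ∣ p ∩ r ∣ + ∣ q ∩ r ∣ ≤ ∣ r ∣
∣p∩r∣+∣q∩r∣≤∣r∣ {p = p} {q} r p∩q=∅ = begin
  ∣ p ∩ r ∣ + ∣ q ∩ r ∣                                    ≡⟨ ∣p∣+∣q∣≡sum (p ∩ r) (q ∩ r) ⟩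
  sum (λ i → 𝟙 (lookup (p ∩ r) i) + 𝟙 (lookup (q ∩ r) i))  ≤⟨ sum-mono-≤ bits ⟩
  sum (𝟙 ∘ lookup r)                                        ≡⟨ ∣p∣≡sum r ⟨
  ∣ r ∣                                                    ∎
  where
  open ≤-Reasoning
  disjoint : ∀ a b c → a Bool.≤ not b → 𝟙 (a ∧ c) + 𝟙 (b ∧ c) ≤ 𝟙 c
  disjoint true  true  _     ()
  disjoint true  false true  _ = ≤-refl
  disjoint true  false false _ = z≤n
  disjoint false true  true  _ = ≤-refl
  disjoint false true  false _ = z≤n
  disjoint false false _     _ = z≤n
  bits : ∀ i → 𝟙 (lookup (p ∩ r) i) + 𝟙 (lookup (q ∩ r) i) ≤ 𝟙 (lookup r i)
  bits i rewrite lookup-∩ {p = p} {r} i | lookup-∩ {p = q} {r} i =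
    disjoint (lookup p i) (lookup q i) (lookup r i) (⊆∁⇒lookup-≤ (Empty∩⇒⊆∁ p∩q=∅) i)

∣p∣+∣q∣+∣r∣≤N+∣p∩r∣+∣q∩r∣ : ∀ {N} {p q : Subset N} (r : Subset N) → Empty (p ∩ q) →
                            ∣ p ∣ + ∣ q ∣ + ∣ r ∣ ≤ N + ∣ p ∩ r ∣ + ∣ q ∩ r ∣
∣p∣+∣q∣+∣r∣≤N+∣p∩r∣+∣q∩r∣ {N} {p} {q} r p∩q=∅ = begin
  ∣ p ∣ + ∣ q ∣ + ∣ r ∣
    ≡⟨ trans (cong₂ _+_ (cong₂ _+_ (∣p∣≡sum p) (∣p∣≡sum q)) (∣p∣≡sum r)) (sum-+₃ (𝟙 ∘ lookup p) _ _) ⟩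
  sum (λ i → 𝟙 (lookup p i) + 𝟙 (lookup q i) + 𝟙 (lookup r i))
    ≤⟨ sum-mono-≤ bits ⟩
  sum (λ i → 1 + 𝟙 (lookup (p ∩ r) i) + 𝟙 (lookup (q ∩ r) i))
    ≡⟨ sum-+₃ (λ (_ : Fin N) → 1) (𝟙 ∘ lookup (p ∩ r)) (𝟙 ∘ lookup (q ∩ r)) ⟨
  sum {N} (λ _ → 1) + sum (𝟙 ∘ lookup (p ∩ r)) + sum (𝟙 ∘ lookup (q ∩ r))
    ≡⟨ cong₂ _+_ (cong₂ _+_ (sum-ones N) (sym (∣p∣≡sum (p ∩ r)))) (sym (∣p∣≡sum (q ∩ r))) ⟩
  N + ∣ p ∩ r ∣ + ∣ q ∩ r ∣
    ∎
  where
  open ≤-Reasoning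
  disjoint : ∀ a b c → a Bool.≤ not b → 𝟙 a + 𝟙 b + 𝟙 c ≤ 1 + 𝟙 (a ∧ c) + 𝟙 (b ∧ c)
  disjoint true  true  _     ()
  disjoint true  false true  _ = ≤-refl
  disjoint true  false false _ = ≤-refl
  disjoint false true  true  _ = ≤-refl
  disjoint false true  false _ = ≤-refl
  disjoint false false true  _ = ≤-refl
  disjoint false false false _ = z≤n
  bits : ∀ i → 𝟙 (lookup p i) + 𝟙 (lookup q i) + 𝟙 (lookup r i) ≤ 1 + 𝟙 (lookup (p ∩ r) i) + 𝟙 (lookup (q ∩ r) i)
  bits i rewrite lookup-∩ {p = p} {r} i | lookup-∩ {p = q} {r} i =
    disjoint (lookup p i) (lookup q i) (lookup r i) (⊆∁⇒lookup-≤ (Empty∩⇒⊆∁ p∩q=∅) i)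

∣[p∩∁a∪b]∩r∣+∣a∩r∣≡∣p∩r∣+∣b∩r∣ : ∀ {N} {p a b : Subset N} (r : Subset N) → a ⊆ p → b ⊆ ∁ p →
                                  ∣ (p ∩ ∁ a ∪ b) ∩ r ∣ + ∣ a ∩ r ∣ ≡ ∣ p ∩ r ∣ + ∣ b ∩ r ∣
∣[p∩∁a∪b]∩r∣+∣a∩r∣≡∣p∩r∣+∣b∩r∣ {p = p} {a} {b} r a⊆p b⊆∁p =
  trans (∣p∣+∣q∣≡sum ((p ∩ ∁ a ∪ b) ∩ r) (a ∩ r)) (trans (sum-cong-≗ bits) (sym (∣p∣+∣q∣≡sum (p ∩ r) (b ∩ r))))
  where
  swap : ∀ x a b c → a Bool.≤ x → b Bool.≤ not x →
         𝟙 (((x ∧ not a) ∨ b) ∧ c) + 𝟙 (a ∧ c) ≡ 𝟙 (x ∧ c) + 𝟙 (b ∧ c)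
  swap true  true  true  _ _ ()
  swap true  true  false c _ _ = sym (+-identityʳ _)
  swap true  false true  _ _ ()
  swap true  false false c _ _ = refl
  swap false true  _     _ () _
  swap false false b     c _ _ = +-identityʳ _
  bits : ∀ i → 𝟙 (lookup ((p ∩ ∁ a ∪ b) ∩ r) i) + 𝟙 (lookup (a ∩ r) i)
             ≡ 𝟙 (lookup (p ∩ r) i) + 𝟙 (lookup (b ∩ r) i)
  bits i rewrite lookup-∩ {p = p ∩ ∁ a ∪ b} {r} i | lookup-∪ {p = p ∩ ∁ a} {b} i | lookup-∩∁ p a i
               | lookup-∩ {p = a} {r} i | lookup-∩ {p = p} {r} i | lookup-∩ {p = b} {r} i =
    swap (lookup p i) (lookup a i) (lookup b i) (lookup r i) (⊆⇒lookup-≤ a⊆p i) (⊆∁⇒lookup-≤ b⊆∁p i)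

-- Walks in the Kneser graph

-- Walkable n k s m: two vertices of K(2n + k, n) meeting in s points are joined by a
-- walk of length m (walk⇔walkable).
data Walkable (n k s : ℕ) : ℕ → Set where
  even : ∀ t → n ≤ s + t * k → Walkable n k s (t * 2)
  odd  : ∀ t → s ≤ t * k → Walkable n k s (suc (t * 2))

_++ᵂ_ : ∀ {N n} {u w v : KVertex N n} {l m} → Walk u w l → Walk w v m → Walk u v (l + m)
here       ++ᵂ q = q
step u~w p ++ᵂ q = step u~w (p ++ᵂ q)

vertex-≡ : ∀ {N n} {u v : KVertex N n} → proj₁ u ≡ proj₁ v → u ≡ v
vertex-≡ {u = p , _} {.p , _} refl = cong (p ,_) (≡-irrelevant _ _)

module Kneser (n k : ℕ) where

  N : ℕ
  N = 2 * n + k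

  Vertex : Set
  Vertex = KVertex N n

  ∣_∩ᵛ_∣ : Vertex → Vertex → ℕ
  ∣ u ∩ᵛ v ∣ = ∣ proj₁ u ∩ proj₁ v ∣

  ∣u∩ᵛu∣≡n : ∀ u → ∣ u ∩ᵛ u ∣ ≡ n
  ∣u∩ᵛu∣≡n (p , ∣p∣≡n) = trans (cong ∣_∣ (∩-idem p)) ∣p∣≡n

  ∣u∩ᵛv∣≤n : ∀ u v → ∣ u ∩ᵛ v ∣ ≤ n
  ∣u∩ᵛv∣≤n (p , ∣p∣≡n) (q , _) = subst (∣ p ∩ q ∣ ≤_) ∣p∣≡n (∣p∩q∣≤∣p∣ p q)

  n≤∣u∩ᵛv∣⇒⊆ : ∀ u v → n ≤ ∣ u ∩ᵛ v ∣ → proj₁ u ⊆ proj₁ v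
  n≤∣u∩ᵛv∣⇒⊆ (p , ∣p∣≡n) (q , _) n≤s x∈p =
    x∉∁p⇒x∈p (λ x∈∁q → ∣p∣≡0⇒Empty ∣p∩∁q∣≡0 (_ , x∈p∩q⁺ (x∈p , x∈∁q)))
    where
    ∣p∩∁q∣≡0 : ∣ p ∩ ∁ q ∣ ≡ 0
    ∣p∩∁q∣≡0 = n≤0⇒n≡0 (+-cancelʳ-≤ _ _ 0 (≤-trans (≤-reflexive (trans (∣p∩∁q∣+∣p∩q∣≡∣p∣ p q) ∣p∣≡n)) n≤s))

  n≤∣u∩ᵛv∣⇒≡ : ∀ {u v} → n ≤ ∣ u ∩ᵛ v ∣ → u ≡ v
  n≤∣u∩ᵛv∣⇒≡ {u} {v} n≤s = vertex-≡ (⊆-antisym (n≤∣u∩ᵛv∣⇒⊆ u v n≤s)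
                                               (n≤∣u∩ᵛv∣⇒⊆ v u (subst (n ≤_) (cong ∣_∣ (∩-comm (proj₁ u) (proj₁ v))) n≤s)))

  adjacent⇒overlaps≤n : ∀ {u w} v → Adj u w → ∣ u ∩ᵛ v ∣ + ∣ w ∩ᵛ v ∣ ≤ n
  adjacent⇒overlaps≤n {u} {w} v@(q , ∣q∣≡n) u~w = subst (∣ u ∩ᵛ v ∣ + ∣ w ∩ᵛ v ∣ ≤_) ∣q∣≡n (∣p∩r∣+∣q∩r∣≤∣r∣ q u~w)

  adjacent⇒n≤overlaps+k : ∀ {u w} v → Adj u w → n ≤ ∣ u ∩ᵛ v ∣ + ∣ w ∩ᵛ v ∣ + k
  adjacent⇒n≤overlaps+k {p , ∣p∣≡n} {q , ∣q∣≡n} (r , ∣r∣≡n) u~w =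
    +-cancelˡ-≤ (n + n) _ _ (begin
      n + n + n                         ≡⟨ cong₂ _+_ (cong₂ _+_ ∣p∣≡n ∣q∣≡n) ∣r∣≡n ⟨
      ∣ p ∣ + ∣ q ∣ + ∣ r ∣             ≤⟨ ∣p∣+∣q∣+∣r∣≤N+∣p∩r∣+∣q∩r∣ r u~w ⟩
      N + ∣ p ∩ r ∣ + ∣ q ∩ r ∣         ≡⟨ solve 4 (λ n k x y → con 2 :* n :+ k :+ x :+ y := n :+ n :+ (x :+ y :+ k)) refl n k _ _ ⟩
      n + n + (∣ p ∩ r ∣ + ∣ q ∩ r ∣ + k) ∎)
    where open ≤-Reasoning

  walk⇒walkable : ∀ {u v m} → Walk u v m → Walkable n k ∣ u ∩ᵛ v ∣ m
  walk⇒walkable {u} here = even 0 (≤-reflexive (sym (trans (+-identityʳ _) (∣u∩ᵛu∣≡n u))))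
  walk⇒walkable {u} {v} (step {w = w} u~w w⇝v) with walk⇒walkable w⇝v
  ... | even t n≤y+tk = odd t (+-cancelʳ-≤ ∣ w ∩ᵛ v ∣ _ _ (begin
        ∣ u ∩ᵛ v ∣ + ∣ w ∩ᵛ v ∣  ≤⟨ adjacent⇒overlaps≤n {u} {w} v u~w ⟩
        n                        ≤⟨ n≤y+tk ⟩
        ∣ w ∩ᵛ v ∣ + t * k       ≡⟨ +-comm ∣ w ∩ᵛ v ∣ (t * k) ⟩
        t * k + ∣ w ∩ᵛ v ∣       ∎))
    where open ≤-Reasoning
  ... | odd t y≤tk = even (suc t) (begin
        n                                 ≤⟨ adjacent⇒n≤overlaps+k {u} {w} v u~w ⟩
        ∣ u ∩ᵛ v ∣ + ∣ w ∩ᵛ v ∣ + k       ≤⟨ +-monoˡ-≤ k (+-monoʳ-≤ ∣ u ∩ᵛ v ∣ y≤tk) ⟩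
        ∣ u ∩ᵛ v ∣ + t * k + k            ≡⟨ solve 3 (λ x a k → x :+ a :+ k := x :+ (k :+ a)) refl ∣ u ∩ᵛ v ∣ (t * k) k ⟩
        ∣ u ∩ᵛ v ∣ + suc t * k            ∎)
    where open ≤-Reasoning

  exchange : (u : Vertex) {a b : Subset N} → a ⊆ proj₁ u → b ⊆ ∁ (proj₁ u) → ∣ a ∣ ≡ ∣ b ∣ → Vertex
  exchange (p , ∣p∣≡n) {a} {b} a⊆p b⊆∁p ∣a∣≡∣b∣ = p ∩ ∁ a ∪ b , +-cancelʳ-≡ ∣ a ∣ _ _ (begin
    ∣ p ∩ ∁ a ∪ b ∣ + ∣ a ∣                   ≡⟨ cong₂ _+_ (∣∩⊤∣ (p ∩ ∁ a ∪ b)) (∣∩⊤∣ a) ⟨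
    ∣ (p ∩ ∁ a ∪ b) ∩ ⊤ ∣ + ∣ a ∩ ⊤ ∣         ≡⟨ ∣[p∩∁a∪b]∩r∣+∣a∩r∣≡∣p∩r∣+∣b∩r∣ ⊤ a⊆p b⊆∁p ⟩
    ∣ p ∩ ⊤ ∣ + ∣ b ∩ ⊤ ∣                     ≡⟨ cong₂ _+_ (trans (∣∩⊤∣ p) ∣p∣≡n) (trans (∣∩⊤∣ b) (sym ∣a∣≡∣b∣)) ⟩
    n + ∣ a ∣                                 ∎)
    where
    open ≡-Reasoning
    ∣∩⊤∣ : ∀ x → ∣ x ∩ ⊤ ∣ ≡ ∣ x ∣
    ∣∩⊤∣ x = cong ∣_∣ (∩-identityʳ x)

  -- The middle vertex is any n-subset of the complement of u ∪ b, which is large enough as ∣b∣ ≤ k.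
  exchange-walk : (u : Vertex) {a b : Subset N} (a⊆u : a ⊆ proj₁ u) (b⊆∁u : b ⊆ ∁ (proj₁ u))
                  (∣a∣≡∣b∣ : ∣ a ∣ ≡ ∣ b ∣) → ∣ b ∣ ≤ k → Walk u (exchange u a⊆u b⊆∁u ∣a∣≡∣b∣) 2
  exchange-walk u@(p , ∣p∣≡n) {a} {b} a⊆p b⊆∁p ∣a∣≡∣b∣ ∣b∣≤k = step {w = w} u~w (step w~u′ here)
    where
    n≤∣∁[p∪b]∣ : n ≤ ∣ ∁ (p ∪ b) ∣
    n≤∣∁[p∪b]∣ = ∣p∣+m≤N⇒m≤∣∁p∣ (p ∪ b) (begin
      ∣ p ∪ b ∣ + n    ≤⟨ +-monoˡ-≤ n (≤-trans (∣p∪q∣≤∣p∣+∣q∣ p b) (+-mono-≤ (≤-reflexive ∣p∣≡n) ∣b∣≤k)) ⟩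
      n + k + n        ≡⟨ solve 2 (λ n k → n :+ k :+ n := con 2 :* n :+ k) refl n k ⟩
      N                ∎)
      where open ≤-Reasoning
    w-choice = ∃-⊆-of-size (∁ (p ∪ b)) n≤∣∁[p∪b]∣
    w : Vertex
    w = proj₁ w-choice , proj₂ (proj₂ w-choice)
    w⊆∁[p∪b] : proj₁ w ⊆ ∁ (p ∪ b)
    w⊆∁[p∪b] = proj₁ (proj₂ w-choice)
    u~w : Adj u w
    u~w = ⊆∁⇒Empty∩ (⊆∁-sym (⊆-trans w⊆∁[p∪b] (p⊆q⇒∁p⊇∁q (p⊆p∪q b))))
    u′⊆p∪b : p ∩ ∁ a ∪ b ⊆ p ∪ b
    u′⊆p∪b x∈u′ = x∈p∪q⁺ (Sum.map₁ (proj₁ ∘ x∈p∩q⁻ p (∁ a)) (x∈p∪q⁻ (p ∩ ∁ a) b x∈u′))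
    w~u′ : Adj w (exchange u a⊆p b⊆∁p ∣a∣≡∣b∣)
    w~u′ = ⊆∁⇒Empty∩ (⊆-trans w⊆∁[p∪b] (p⊆q⇒∁p⊇∁q u′⊆p∪b))

  exchange-toward : ∀ u v {r} → r ≤ k → r ≤ ∣ proj₁ u ∩ ∁ (proj₁ v) ∣ →
                    ∃[ u′ ] Walk u u′ 2 × ∣ u′ ∩ᵛ v ∣ ≡ ∣ u ∩ᵛ v ∣ + r
  exchange-toward u@(p , ∣p∣≡n) v@(q , ∣q∣≡n) {r} r≤k r≤∣p∩∁q∣ =
    exchange u a⊆p b⊆∁p ∣a∣≡∣b∣ , exchange-walk u a⊆p b⊆∁p ∣a∣≡∣b∣ (≤-trans (≤-reflexive ∣b∣≡r) r≤k) , u′∩v-size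
    where
    ∣q∩∁p∣≡∣p∩∁q∣ : ∣ q ∩ ∁ p ∣ ≡ ∣ p ∩ ∁ q ∣
    ∣q∩∁p∣≡∣p∩∁q∣ = +-cancelʳ-≡ ∣ p ∩ q ∣ _ _ (begin
      ∣ q ∩ ∁ p ∣ + ∣ p ∩ q ∣  ≡⟨ cong (λ x → ∣ q ∩ ∁ p ∣ + ∣ x ∣) (∩-comm p q) ⟩
      ∣ q ∩ ∁ p ∣ + ∣ q ∩ p ∣  ≡⟨ trans (∣p∩∁q∣+∣p∩q∣≡∣p∣ q p) (trans ∣q∣≡n (sym ∣p∣≡n)) ⟩
      ∣ p ∣                    ≡⟨ ∣p∩∁q∣+∣p∩q∣≡∣p∣ p q ⟨
      ∣ p ∩ ∁ q ∣ + ∣ p ∩ q ∣  ∎)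
      where open ≡-Reasoning
    a-choice = ∃-⊆-of-size (p ∩ ∁ q) r≤∣p∩∁q∣
    b-choice = ∃-⊆-of-size (q ∩ ∁ p) (≤-trans r≤∣p∩∁q∣ (≤-reflexive (sym ∣q∩∁p∣≡∣p∩∁q∣)))
    a = proj₁ a-choice
    b = proj₁ b-choice
    ∣b∣≡r = proj₂ (proj₂ b-choice)
    ∣a∣≡∣b∣ = trans (proj₂ (proj₂ a-choice)) (sym ∣b∣≡r)
    a⊆p = ⊆-trans (proj₁ (proj₂ a-choice)) (p∩q⊆p p (∁ q))
    a⊆∁q = ⊆-trans (proj₁ (proj₂ a-choice)) (p∩q⊆q p (∁ q))
    b⊆∁p = ⊆-trans (proj₁ (proj₂ b-choice)) (p∩q⊆q q (∁ p))
    b⊆q = ⊆-trans (proj₁ (proj₂ b-choice)) (p∩q⊆p q (∁ p))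
    u′∩v-size : ∣ exchange u a⊆p b⊆∁p ∣a∣≡∣b∣ ∩ᵛ v ∣ ≡ ∣ p ∩ q ∣ + r
    u′∩v-size = begin
      ∣ (p ∩ ∁ a ∪ b) ∩ q ∣                ≡⟨ +-identityʳ _ ⟨
      ∣ (p ∩ ∁ a ∪ b) ∩ q ∣ + 0            ≡⟨ cong (_+_ ∣ (p ∩ ∁ a ∪ b) ∩ q ∣) (⊆∁⇒∣p∩q∣≡0 a⊆∁q) ⟨
      ∣ (p ∩ ∁ a ∪ b) ∩ q ∣ + ∣ a ∩ q ∣    ≡⟨ ∣[p∩∁a∪b]∩r∣+∣a∩r∣≡∣p∩r∣+∣b∩r∣ q a⊆p b⊆∁p ⟩
      ∣ p ∩ q ∣ + ∣ b ∩ q ∣                ≡⟨ cong (_+_ ∣ p ∩ q ∣) (trans (⊆⇒∣p∩q∣≡∣p∣ b⊆q) ∣b∣≡r) ⟩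
      ∣ p ∩ q ∣ + r                        ∎
      where open ≡-Reasoning

  exchange-away : ∀ u v {r} → r ≤ k → r ≤ ∣ u ∩ᵛ v ∣ → ∃[ u′ ] Walk u u′ 2 × ∣ u′ ∩ᵛ v ∣ + r ≡ ∣ u ∩ᵛ v ∣
  exchange-away u@(p , ∣p∣≡n) v@(q , ∣q∣≡n) {r} r≤k r≤∣p∩q∣ =
    exchange u a⊆p b⊆∁p ∣a∣≡∣b∣ , exchange-walk u a⊆p b⊆∁p ∣a∣≡∣b∣ (≤-trans (≤-reflexive ∣b∣≡r) r≤k) , u′∩v-size
    where
    k≤∣∁[p∪q]∣ : k ≤ ∣ ∁ (p ∪ q) ∣
    k≤∣∁[p∪q]∣ = ∣p∣+m≤N⇒m≤∣∁p∣ (p ∪ q) (begin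
      ∣ p ∪ q ∣ + k    ≤⟨ +-monoˡ-≤ k (≤-trans (∣p∪q∣≤∣p∣+∣q∣ p q) (≤-reflexive (cong₂ _+_ ∣p∣≡n ∣q∣≡n))) ⟩
      n + n + k        ≡⟨ solve 2 (λ n k → n :+ n :+ k := con 2 :* n :+ k) refl n k ⟩
      N                ∎)
      where open ≤-Reasoning
    a-choice = ∃-⊆-of-size (p ∩ q) r≤∣p∩q∣
    b-choice = ∃-⊆-of-size (∁ (p ∪ q)) (≤-trans r≤k k≤∣∁[p∪q]∣)
    a = proj₁ a-choice
    b = proj₁ b-choice
    ∣a∣≡r = proj₂ (proj₂ a-choice)
    ∣b∣≡r = proj₂ (proj₂ b-choice)
    ∣a∣≡∣b∣ = trans ∣a∣≡r (sym ∣b∣≡r)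
    a⊆p = ⊆-trans (proj₁ (proj₂ a-choice)) (p∩q⊆p p q)
    a⊆q = ⊆-trans (proj₁ (proj₂ a-choice)) (p∩q⊆q p q)
    b⊆∁p = ⊆-trans (proj₁ (proj₂ b-choice)) (p⊆q⇒∁p⊇∁q (p⊆p∪q q))
    b⊆∁q = ⊆-trans (proj₁ (proj₂ b-choice)) (p⊆q⇒∁p⊇∁q (q⊆p∪q p q))
    u′∩v-size : ∣ exchange u a⊆p b⊆∁p ∣a∣≡∣b∣ ∩ᵛ v ∣ + r ≡ ∣ p ∩ q ∣
    u′∩v-size = begin
      ∣ (p ∩ ∁ a ∪ b) ∩ q ∣ + r            ≡⟨ cong (_+_ ∣ (p ∩ ∁ a ∪ b) ∩ q ∣) (trans (⊆⇒∣p∩q∣≡∣p∣ a⊆q) ∣a∣≡r) ⟨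
      ∣ (p ∩ ∁ a ∪ b) ∩ q ∣ + ∣ a ∩ q ∣    ≡⟨ ∣[p∩∁a∪b]∩r∣+∣a∩r∣≡∣p∩r∣+∣b∩r∣ q a⊆p b⊆∁p ⟩
      ∣ p ∩ q ∣ + ∣ b ∩ q ∣                ≡⟨ cong (_+_ ∣ p ∩ q ∣) (⊆∁⇒∣p∩q∣≡0 b⊆∁q) ⟩
      ∣ p ∩ q ∣ + 0                        ≡⟨ +-identityʳ _ ⟩
      ∣ p ∩ q ∣                            ∎
      where open ≡-Reasoning

  even-walk : ∀ t {u v} → n ≤ ∣ u ∩ᵛ v ∣ + t * k → Walk u v (t * 2)
  even-walk zero    {u} n≤s+0 = subst (λ v → Walk u v 0) (n≤∣u∩ᵛv∣⇒≡ (subst (n ≤_) (+-identityʳ _) n≤s+0)) here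
  even-walk (suc t) {u} {v} n≤s+k+tk =
    let u′ , u⇝u′ , s′≡s+r = exchange-toward u v (m⊓n≤m k d) (m⊓n≤n k d)
    in  u⇝u′ ++ᵂ even-walk t (subst (λ x → n ≤ x + t * k) (sym s′≡s+r) n≤s+r+tk)
    where
    s = ∣ u ∩ᵛ v ∣
    d = ∣ proj₁ u ∩ ∁ (proj₁ v) ∣
    n≤s+r+tk : n ≤ s + k ⊓ d + t * k
    n≤s+r+tk with ⊓-sel k d
    ... | inj₁ k⊓d≡k = subst (λ x → n ≤ s + x + t * k) (sym k⊓d≡k) (≤-trans n≤s+k+tk (≤-reflexive (sym (+-assoc s k (t * k)))))
    ... | inj₂ k⊓d≡d = subst (λ x → n ≤ s + x + t * k) (sym k⊓d≡d) (≤-trans (≤-reflexive n≡s+d) (m≤m+n (s + d) (t * k)))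
      where
      n≡s+d : n ≡ s + d
      n≡s+d = trans (sym (trans (∣p∩∁q∣+∣p∩q∣≡∣p∣ (proj₁ u) (proj₁ v)) (proj₂ u))) (+-comm d s)

  odd-walk : ∀ t {u v} → ∣ u ∩ᵛ v ∣ ≤ t * k → Walk u v (suc (t * 2))
  odd-walk zero    {u} {v} s≤0 = step (∣p∣≡0⇒Empty (n≤0⇒n≡0 s≤0)) here
  odd-walk (suc t) {u} {v} s≤k+tk =
    let u′ , u⇝u′ , s′+r≡s = exchange-away u v (m⊓n≤m k s) (m⊓n≤n k s)
    in  u⇝u′ ++ᵂ odd-walk t (s′≤tk s′+r≡s)
    where
    s = ∣ u ∩ᵛ v ∣
    s′≤tk : ∀ {s′} → s′ + k ⊓ s ≡ s → s′ ≤ t * k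
    s′≤tk {s′} s′+r≡s with ⊓-sel k s
    ... | inj₁ k⊓s≡k = +-cancelʳ-≤ k s′ (t * k)
                         (≤-trans (≤-reflexive (trans (cong (_+_ s′) (sym k⊓s≡k)) s′+r≡s)) (≤-trans s≤k+tk (≤-reflexive (+-comm k (t * k)))))
    ... | inj₂ k⊓s≡s = subst (_≤ t * k) (sym (+-cancelʳ-≡ s s′ 0 (trans (cong (_+_ s′) (sym k⊓s≡s)) s′+r≡s))) z≤n

  walk⇔walkable : ∀ {u v m} → Walk u v m ⇔ Walkable n k ∣ u ∩ᵛ v ∣ m
  walk⇔walkable = mk⇔ walk⇒walkable walkable⇒walk
    where
    walkable⇒walk : ∀ {u v m} → Walkable n k ∣ u ∩ᵛ v ∣ m → Walk u v m
    walkable⇒walk (even t n≤s+tk) = even-walk t n≤s+tk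
    walkable⇒walk (odd t s≤tk)    = odd-walk t s≤tk

  overlap-realisable : ∀ {s} → s ≤ n → ∃[ u ] ∃[ v ] ∣ u ∩ᵛ v ∣ ≡ s
  overlap-realisable {s} s≤n = exchange u a⊆p b⊆∁p ∣a∣≡∣b∣ , u , +-cancelʳ-≡ (n ∸ s) _ s (begin
    ∣ (p ∩ ∁ a ∪ b) ∩ p ∣ + (n ∸ s)       ≡⟨ cong (_+_ ∣ (p ∩ ∁ a ∪ b) ∩ p ∣) (trans (⊆⇒∣p∩q∣≡∣p∣ a⊆p) ∣a∣≡n∸s) ⟨
    ∣ (p ∩ ∁ a ∪ b) ∩ p ∣ + ∣ a ∩ p ∣     ≡⟨ ∣[p∩∁a∪b]∩r∣+∣a∩r∣≡∣p∩r∣+∣b∩r∣ p a⊆p b⊆∁p ⟩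
    ∣ p ∩ p ∣ + ∣ b ∩ p ∣                 ≡⟨ cong₂ _+_ (∣u∩ᵛu∣≡n u) (⊆∁⇒∣p∩q∣≡0 b⊆∁p) ⟩
    n + 0                                 ≡⟨ +-identityʳ n ⟩
    n                                     ≡⟨ m+[n∸m]≡n s≤n ⟨
    s + (n ∸ s)                           ∎)
    where
    open ≡-Reasoning
    n≤N : n ≤ N
    n≤N = ≤-trans (m≤m+n n (n + 0)) (m≤m+n (2 * n) k)
    p-choice = ∃-⊆-of-size ⊤ (subst (n ≤_) (sym (∣⊤∣≡n N)) n≤N)
    p = proj₁ p-choice
    u : Vertex
    u = p , proj₂ (proj₂ p-choice)
    n≤∣∁p∣ : n ≤ ∣ ∁ p ∣
    n≤∣∁p∣ = ∣p∣+m≤N⇒m≤∣∁p∣ p (≤-trans (≤-reflexive (cong (λ x → x + n) (proj₂ u)))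
                                       (≤-trans (+-monoʳ-≤ n (m≤m+n n 0)) (m≤m+n (2 * n) k)))
    a-choice = ∃-⊆-of-size p (subst (n ∸ s ≤_) (sym (proj₂ u)) (m∸n≤m n s))
    b-choice = ∃-⊆-of-size (∁ p) (≤-trans (m∸n≤m n s) n≤∣∁p∣)
    a = proj₁ a-choice
    b = proj₁ b-choice
    a⊆p = proj₁ (proj₂ a-choice)
    b⊆∁p = proj₁ (proj₂ b-choice)
    ∣a∣≡n∸s = proj₂ (proj₂ a-choice)
    ∣a∣≡∣b∣ = trans ∣a∣≡n∸s (sym (proj₂ (proj₂ b-choice)))

-- The arithmetic of walkable lengths

Least : (ℕ → Set) → ℕ → Set
Least P d = P d × (∀ m → m < d → ¬ P m)

Least-cong : ∀ {P Q : ℕ → Set} {d} → (∀ {m} → P m ⇔ Q m) → Least P d ⇔ Least Q d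
Least-cong P⇔Q = mk⇔
  (λ (p , none) → Equivalence.to P⇔Q p , λ m m<d q → none m m<d (Equivalence.from P⇔Q q))
  (λ (q , none) → Equivalence.from P⇔Q q , λ m m<d p → none m m<d (Equivalence.to P⇔Q p))

Least-≤ : ∀ {P : ℕ → Set} {d m} → Least P d → P m → d ≤ m
Least-≤ (_ , none) pm = ≮⇒≥ (λ m<d → none _ m<d pm)

InRange : ℕ → ℕ → ℕ → Set
InRange n k s = (lowerB n k ℤ.≤ + s) × (+ s ℤ.≤ upperB n k)

InRange⇔ : ∀ {n k a r s} → lowerB n k ≡ + suc a → H n k ≡ r → InRange n k s ⇔ (a < s × s ≤ suc (a + r))
InRange⇔ {n} {k} {s = s} lowerB≡ H≡ = mk⇔
  (λ (lo , hi) → drop‿+≤+ (subst (ℤ._≤ + s) lowerB≡ lo) , drop‿+≤+ (subst (+ s ℤ.≤_) upperB≡ hi))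
  (λ (a<s , s≤) → subst (ℤ._≤ + s) (sym lowerB≡) (+≤+ a<s) , subst (+ s ℤ.≤_) (sym upperB≡) (+≤+ s≤))
  where
  upperB≡ = cong₂ ℤ._+_ lowerB≡ (cong +_ H≡)

record Diameter (n k D : ℕ) : Set where
  field
    walkable-within : ∀ s → s ≤ n → ∃[ m ] m ≤ D × Walkable n k s m
    least⇔InRange   : ∀ s → s < n → Least (Walkable n k s) D ⇔ InRange n k s
    InRange-witness : ∃[ s ] s < n × InRange n k s

-- 2t + 1 and 2e are the longest odd and even lengths below D; a pair meeting in s
-- points is at distance D exactly when neither of them is walkable.
module DiameterCandidate {n k r t e D : ℕ}
  (n≡ : n ≡ suc (suc (t * k + r) + e * k))
  (odd<D : suc (t * 2) < D) (even<D : e * 2 < D)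
  (odd-below : ∀ {t′} → suc (t′ * 2) < D → t′ ≤ t)
  (even-below : ∀ {t′} → t′ * 2 < D → t′ ≤ e)
  (walkable-D : ∀ {s} → t * k < s → s ≤ suc (t * k + r) → Walkable n k s D)
  where

  unwalkable-below : ∀ {s} → t * k < s → s + e * k < n → ∀ m → m < D → ¬ Walkable n k s m
  unwalkable-below {s} _ s+ek<n m m<D (even t′ n≤s+t′k) =
    <⇒≱ s+ek<n (≤-trans n≤s+t′k (+-monoʳ-≤ s (*-monoˡ-≤ k (even-below {t′} m<D))))
  unwalkable-below tk<s _ m m<D (odd t′ s≤t′k) =
    <⇒≱ tk<s (≤-trans s≤t′k (*-monoˡ-≤ k (odd-below {t′} m<D)))

  s+ek<n⇔ : ∀ {s} → s + e * k < n ⇔ s ≤ suc (t * k + r)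
  s+ek<n⇔ {s} = mk⇔
    (λ lt → +-cancelʳ-≤ (e * k) s _ (≤-pred (subst (s + e * k <_) n≡ lt)))
    (λ le → subst (s + e * k <_) (sym n≡) (s≤s (+-monoˡ-≤ (e * k) le)))

  least⇔ : ∀ {s} → Least (Walkable n k s) D ⇔ (t * k < s × s ≤ suc (t * k + r))
  least⇔ = mk⇔
    (λ (_ , none) → ≰⇒> (λ s≤tk → none _ odd<D (odd t s≤tk))
                  , to s+ek<n⇔ (≰⇒> (λ n≤ → none _ even<D (even e n≤))))
    (λ (tk<s , s≤) → walkable-D tk<s s≤ , unwalkable-below tk<s (from s+ek<n⇔ s≤))
    where open Equivalence

  walkable-within-D : ∀ s → ∃[ m ] m ≤ D × Walkable n k s m
  walkable-within-D s with t * k <? s | s + e * k <? n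
  ... | no s≤tk | _     = _ , <⇒≤ odd<D , odd t (≮⇒≥ s≤tk)
  ... | yes _   | no n≤ = _ , <⇒≤ even<D , even e (≮⇒≥ n≤)
  ... | yes tk<s | yes s+ek<n = D , ≤-refl , walkable-D tk<s (Equivalence.to s+ek<n⇔ s+ek<n)

  diameter : lowerB n k ≡ + suc (t * k) → H n k ≡ r → Diameter n k D
  diameter lowerB≡ H≡ = record
    { walkable-within = λ s _ → walkable-within-D s
    ; least⇔InRange   = λ s _ → ⇔-trans least⇔ (⇔-sym (InRange⇔ {n} {k} lowerB≡ H≡))
    ; InRange-witness = suc (t * k) , tk<n , Equivalence.from (InRange⇔ {n} {k} lowerB≡ H≡) (≤-refl , s≤s (m≤m+n _ r))
    }
    where
    tk<n : suc (t * k) < n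
    tk<n = subst (suc (t * k) <_) (sym n≡) (s≤s (s≤s (≤-trans (m≤m+n (t * k) r) (m≤m+n _ (e * k)))))

[r+q*d]/d≡q : ∀ {r d} q .{{_ : NonZero d}} → r < d → (r + q * d) / d ≡ q
[r+q*d]/d≡q {r} {d} q r<d = begin
  (r + q * d) / d    ≡⟨ +-distrib-/-∣ʳ r (divides q refl) ⟩
  r / d + q * d / d  ≡⟨ cong₂ _+_ (m<n⇒m/n≡0 r<d) (m*n/n≡m q d) ⟩
  q                  ∎
  where open ≡-Reasoning

ceilTerm≡ : ∀ {n k′ t c} → c < 2 * suc k′ → (n ∸ 1) + (2 * suc k′ ∸ 1) ≡ c + suc t * (2 * suc k′) →
            ceilTerm n (suc k′) ≡ suc t
ceilTerm≡ {k′ = k′} {t} c<2k eq = trans (cong (_/ (2 * suc k′)) eq) ([r+q*d]/d≡q (suc t) c<2k)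

lowerB≡ : ∀ {n k t} → ceilTerm n k ≡ suc t → lowerB n k ≡ + suc (t * k)
lowerB≡ {n} {k} {t} ceil≡ = begin
  lowerB n k                         ≡⟨ cong (λ c → (+ c ℤ.- + 1) ℤ.* + k ℤ.+ + 1) ceil≡ ⟩
  + t ℤ.* + k ℤ.+ + 1                ≡⟨ cong (ℤ._+ + 1) (sym (pos-* t k)) ⟩
  + (t * k + 1)                      ≡⟨ cong +_ (+-comm (t * k) 1) ⟩
  + suc (t * k)                      ∎
  where open ≡-Reasoning

H≡ : ∀ {k′ r} q → r < suc k′ → H (suc (suc (r + q * suc k′))) (suc k′) ≡ r
H≡ {k′} {r} q r<k = trans (cong (Hmod (suc k′)) ([m+kn]%n≡m%n (2 + r) q (suc k′))) (Hmod-2+r r<k)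
  where
  Hmod : ℕ → ℕ → ℕ
  Hmod k m = if m ≤ᵇ 1 then (m + k) ∸ 2 else m ∸ 2
  Hmod-1 : ∀ r → Hmod (suc r) (1 % suc r) ≡ r
  Hmod-1 zero    = refl
  Hmod-1 (suc r) = refl
  Hmod-2+r : ∀ {k r} → r < suc k → Hmod (suc k) ((2 + r) % suc k) ≡ r
  Hmod-2+r {k} {r} r<k with <-cmp (2 + r) (suc k)
  ... | tri< 2+r<k _ _ = cong (Hmod (suc k)) (m<n⇒m%n≡m 2+r<k)
  ... | tri≈ _ refl _  = cong (Hmod (suc k)) (n%n≡0 (2 + r))
  ... | tri> _ _ k<2+r with ≤-antisym r<k (≤-pred k<2+r)
  ... | refl = trans (cong (Hmod (suc r)) ([m+n]%n≡m%n 1 (suc r))) (Hmod-1 r)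

data Parity : ℕ → Set where
  even : ∀ t → Parity (t * 2)
  odd  : ∀ t → Parity (suc (t * 2))

parity : ∀ q → Parity q
parity zero = even 0
parity (suc q) with parity q
... | even t = odd t
... | odd t  = even (suc t)

*2<*2⇒≤ : ∀ {t′ t} → t′ * 2 < suc t * 2 → t′ ≤ t
*2<*2⇒≤ lt = ≤-pred (*-cancelʳ-< 2 _ _ lt)

diameter-even : ∀ {k′ r} t → r < suc k′ → Diameter (suc (suc (r + t * 2 * suc k′))) (suc k′) (suc t * 2)
diameter-even {k′} {r} t r<k =
  DiameterCandidate.diameter {t = t} {e = t} n≡ ≤-refl (s≤s (n≤1+n _)) odd-below *2<*2⇒≤ walkable-D
    (lowerB≡ {n} {k} (ceilTerm≡ {n} {t = t} (≤-trans r<k (m≤m+n k _)) ceil-eq)) (H≡ (t * 2) r<k)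
  where
  k = suc k′
  n = suc (suc (r + t * 2 * k))
  n≡ : n ≡ suc (suc (t * k + r) + t * k)
  n≡ = cong (suc ∘ suc) (solve 3 (λ r t k → r :+ t :* con 2 :* k := t :* k :+ r :+ t :* k) refl r t k)
  odd-below : ∀ {t′} → suc (t′ * 2) < suc t * 2 → t′ ≤ t
  odd-below lt = *2<*2⇒≤ (<-trans (n<1+n _) lt)
  walkable-D : ∀ {s} → t * k < s → s ≤ suc (t * k + r) → Walkable n k s (suc t * 2)
  walkable-D {s} tk<s _ = even (suc t) (begin
    suc (suc (r + t * 2 * k))    ≡⟨ solve 3 (λ r t k → con 2 :+ (r :+ t :* con 2 :* k) := (con 1 :+ t :* k) :+ ((con 1 :+ r) :+ t :* k)) refl r t k ⟩
    suc (t * k) + (suc r + t * k) ≤⟨ +-mono-≤ tk<s (+-monoˡ-≤ (t * k) r<k) ⟩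
    s + (k + t * k)              ∎)
    where open ≤-Reasoning
  ceil-eq : suc (suc (r + t * 2 * k)) ∸ 1 + (2 * k ∸ 1) ≡ r + suc t * (2 * k)
  ceil-eq = solve 3 (λ r t k′ → con 1 :+ r :+ t :* con 2 :* (con 1 :+ k′) :+ (k′ :+ (con 1 :+ (k′ :+ con 0)))
                                := r :+ (con 1 :+ t) :* (con 2 :* (con 1 :+ k′))) refl r t k′

diameter-odd : ∀ {k′ r} t → r < suc k′ → Diameter (suc (suc (r + suc (t * 2) * suc k′))) (suc k′) (suc (suc t * 2))
diameter-odd {k′} {r} t r<k =
  DiameterCandidate.diameter {t = t} {e = suc t} n≡ (s≤s (n≤1+n _)) ≤-refl (*2<*2⇒≤ ∘ ≤-pred) even-below walkable-D
    (lowerB≡ {n} {k} (ceilTerm≡ {n} {t = t} r+k<2k ceil-eq)) (H≡ (suc (t * 2)) r<k)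
  where
  k = suc k′
  n = suc (suc (r + suc (t * 2) * k))
  n≡ : n ≡ suc (suc (t * k + r) + suc t * k)
  n≡ = cong (suc ∘ suc) (solve 3 (λ r t k → r :+ (con 1 :+ t :* con 2) :* k := t :* k :+ r :+ (k :+ t :* k)) refl r t k)
  even-below : ∀ {t′} → t′ * 2 < suc (suc t * 2) → t′ ≤ suc t
  even-below (s≤s le) = *-cancelʳ-≤ _ _ 2 le
  walkable-D : ∀ {s} → t * k < s → s ≤ suc (t * k + r) → Walkable n k s (suc (suc t * 2))
  walkable-D {s} _ s≤ = odd (suc t) (begin
    s                ≤⟨ s≤ ⟩
    suc (t * k + r)  ≡⟨ +-suc (t * k) r ⟨
    t * k + suc r    ≤⟨ +-monoʳ-≤ (t * k) r<k ⟩
    t * k + k        ≡⟨ +-comm (t * k) k ⟩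
    k + t * k        ∎)
    where open ≤-Reasoning
  r+k<2k : r + k < 2 * k
  r+k<2k = subst (r + k <_) (cong (λ m → k + m) (sym (+-identityʳ k))) (+-monoˡ-< k r<k)
  ceil-eq : n ∸ 1 + (2 * k ∸ 1) ≡ r + k + suc t * (2 * k)
  ceil-eq = solve 3 (λ r t k′ → con 1 :+ r :+ (con 1 :+ t :* con 2) :* (con 1 :+ k′) :+ (k′ :+ (con 1 :+ (k′ :+ con 0)))
                                := r :+ (con 1 :+ k′) :+ (con 1 :+ t) :* (con 2 :* (con 1 :+ k′))) refl r t k′

diameter-≥2 : ∀ {k′ r} q → r < suc k′ → Σ ℕ (Diameter (suc (suc (r + q * suc k′))) (suc k′))
diameter-≥2 q r<k with parity q
... | even t = suc t * 2 , diameter-even t r<k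
... | odd t  = suc (suc t * 2) , diameter-odd t r<k

InRange-1 : ∀ k′ → InRange 1 (suc k′) 0
InRange-1 zero    = +≤+ z≤n , +≤+ z≤n
InRange-1 (suc m) = subst (ℤ._≤ + 0) (sym lowerB-1≡) -≤+ , subst (+ 0 ℤ.≤_) (sym upperB-1≡) (+≤+ z≤n)
  where
  lowerB-1≡ : lowerB 1 (2 + m) ≡ -[1+ m ]
  lowerB-1≡ = trans (cong (λ c → (+ c ℤ.- + 1) ℤ.* + (2 + m) ℤ.+ + 1) (m<n⇒m/n≡0 {n = 2 * (2 + m)} ≤-refl))
                    (cong -[1+_] (+-identityʳ m))
  upperB-1≡ : upperB 1 (2 + m) ≡ + 0
  upperB-1≡ = trans (cong (ℤ._+ + suc m) lowerB-1≡) (n⊖n≡0 (suc m))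

-- For n = 1 the graph is complete, and the bounds of the statement are 1 − k and 0.
diameter-1 : ∀ k′ → Diameter 1 (suc k′) 1
diameter-1 k′ = record
  { walkable-within = λ { zero _ → 1 , ≤-refl , odd 0 z≤n
                        ; (suc zero) _ → 0 , z≤n , even 0 ≤-refl
                        ; (suc (suc _)) (s≤s ()) }
  ; least⇔InRange   = λ { zero _ → mk⇔ (λ _ → InRange-1 k′) (λ _ → odd 0 z≤n , unwalkable-0)
                        ; (suc _) (s≤s ()) }
  ; InRange-witness = 0 , s≤s z≤n , InRange-1 k′
  }
  where
  unwalkable-0 : ∀ m → m < 1 → ¬ Walkable 1 (suc k′) 0 m
  unwalkable-0 _ _        (even zero ())
  unwalkable-0 _ (s≤s ()) (even (suc _) _)
  unwalkable-0 _ (s≤s ()) (odd _ _)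

walkable-diameter : ∀ n k → 1 ≤ n → 1 ≤ k → Σ ℕ (Diameter n k)
walkable-diameter 1             (suc k′) _ _ = 1 , diameter-1 k′
walkable-diameter (suc (suc x)) (suc k′) _ _ =
  subst (λ n → Σ ℕ (Diameter n (suc k′))) (cong (suc ∘ suc) (sym (m≡m%n+[m/n]*n x (suc k′))))
        (diameter-≥2 (x / suc k′) (m%n<n x (suc k′)))

theorem1 : (n k : ℕ) → 1 ≤ n → 1 ≤ k →
    Σ ℕ λ D → IsDiam (2 * n + k) n D ×
      ((u v : KVertex (2 * n + k) n) → ¬ (proj₁ u ≡ proj₁ v) →
        (Dist u v D ⇔
          ((lowerB n k ℤ.≤ + ∣ proj₁ u ∩ proj₁ v ∣) ×
           (+ ∣ proj₁ u ∩ proj₁ v ∣ ℤ.≤ upperB n k))))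
theorem1 n k 1≤n 1≤k = D , (attained , bounded) , characterisation
  where
  open Kneser n k
  D = proj₁ (walkable-diameter n k 1≤n 1≤k)
  open Diameter (proj₂ (walkable-diameter n k 1≤n 1≤k))
  open Equivalence

  dist⇔ : ∀ {u v d} → Dist u v d ⇔ Least (Walkable n k ∣ u ∩ᵛ v ∣) d
  dist⇔ = Least-cong walk⇔walkable

  attained : ∃[ u ] ∃[ v ] Dist u v D
  attained =
    let s , s<n , inRange = InRange-witness
        u , v , ∣u∩v∣≡s   = overlap-realisable (<⇒≤ s<n)
    in  u , v , from dist⇔ (subst (λ s → Least (Walkable n k s) D) (sym ∣u∩v∣≡s) (from (least⇔InRange s s<n) inRange))

  bounded : ∀ u v d → Dist u v d → d ≤ D
  bounded u v d dist =
    let m , m≤D , walkable = walkable-within ∣ u ∩ᵛ v ∣ (∣u∩ᵛv∣≤n u v)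
    in  ≤-trans (Least-≤ (to dist⇔ dist) walkable) m≤D

  characterisation : ∀ u v → ¬ (proj₁ u ≡ proj₁ v) → Dist u v D ⇔ InRange n k ∣ u ∩ᵛ v ∣
  characterisation u v u≢v = ⇔-trans dist⇔ (least⇔InRange _ s<n)
    where
    s<n : ∣ u ∩ᵛ v ∣ < n
    s<n = ≤∧≢⇒< (∣u∩ᵛv∣≤n u v) (λ s≡n → u≢v (cong proj₁ (n≤∣u∩ᵛv∣⇒≡ {u} {v} (≤-reflexive (sym s≡n)))))
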